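{- For every integer $n\geq 4$, every $2$-colouring of $F_n\boxtimes F_n$ has clustering at least $\frac{1}{3}n^{4/3}$.
   Context: All graphs are finite and simple. The fan $F_n$ is the graph obtained from the path on $n$ vertices by adding one new vertex adjacent to every vertex of the path. A colouring of a graph assigns a colour to each vertex (adjacent vertices may receive the same colour); a $c$-colouring uses at most $c$ colours. A monochromatic component is a connected component of the subgraph induced by the vertices of one colour. "Every colouring has clustering at least $k$" means every such colouring has a monochromatic component with at least $k$ vertices. The strong product $G\boxtimes H$ has vertex set $V(G)\times V(H)$, with distinct $(u,v),(u',v')$ adjacent iff ($u=u'$ and $vv'\in E(H)$) or ($v=v'$ and $uu'\in E(G)$) or ($uu'\in E(G)$ and $vv'\in E(H)$). -}

module Defs where

open import Data.Nat using (ℕ; zero; suc; _≤_; _*_; _^_)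
open import Data.Fin using (Fin; zero; suc; toℕ)
open import Data.Product using (_×_; Σ; ∃-syntax; _,_)
open import Data.Sum using (_⊎_)
open import Data.Empty using (⊥)
open import Data.Unit using (⊤)
open import Data.List using (List; length)
open import Data.List.Relation.Unary.All using (All)
open import Data.List.Relation.Unary.Unique.Propositional using (Unique)
open import Relation.Binary.PropositionalEquality using (_≡_)

record Graph : Set₁ where
  field
    V   : Set
    Adj : V → V → Set
open Graph public

-- Fan F_n: vertex 'zero' is the apex; 'suc i' (i : Fin n) is the i-th path vertex.
FanAdj : (n : ℕ) → Fin (suc n) → Fin (suc n) → Set
FanAdj n zero    zero    = ⊥
FanAdj n zero    (suc j) = ⊤
FanAdj n (suc i) zero    = ⊤
FanAdj n (suc i) (suc j) = (toℕ j ≡ suc (toℕ i)) ⊎ (toℕ i ≡ suc (toℕ j))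

Fan : ℕ → Graph
Fan n = record { V = Fin (suc n) ; Adj = FanAdj n }

_⊠_ : Graph → Graph → Graph
G ⊠ H = record
  { V   = V G × V H
  ; Adj = λ { (u , v) (u' , v') →
              (u ≡ u' × Adj H v v')
            ⊎ (v ≡ v' × Adj G u u')
            ⊎ (Adj G u u' × Adj H v v') } }

-- A c-colouring (no properness condition).
Colouring : Graph → ℕ → Set
Colouring G c = V G → Fin c

-- MonoReach G col u w : w is reachable from u by a walk whose vertices all
-- have the colour of u (i.e. u and w lie in the same monochromatic component).
data MonoReach (G : Graph) {c : ℕ} (col : Colouring G c) : V G → V G → Set where
  here : ∀ {u} → MonoReach G col u u
  step : ∀ {u v w} → MonoReach G col u v → Adj G v w → col w ≡ col u →
         MonoReach G col u w

HasMonoComponentOfSize≥ : (G : Graph) {c : ℕ} → Colouring G c → ℕ → Set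
HasMonoComponentOfSize≥ G col k =
  ∃[ u ] ∃[ ws ] (Unique ws × All (MonoReach G col u) ws × k ≤ length ws)

EveryColouringHasClustering≥ : Graph → ℕ → ℕ → Set
EveryColouringHasClustering≥ G c k =
  (col : Colouring G c) → HasMonoComponentOfSize≥ G col k

-- The apex pair (0,0) of F_n ⊠ F_n dominates the n × n grid of path pairs, so the red cells
-- (those coloured like (0,0)) all lie in one component. Cut a qk × qk corner of the grid into
-- q² blocks of side k. If there are at least q²h red cells the red component is large;
-- otherwise some block has fewer than h ≤ k red cells. That block then has a red-free column
-- and more than k − h red-free rows, and all of these cells form one blue component of size
-- at least k(k − h + 1). With q ≈ n^{1/3}, k ≈ n^{2/3} and h ≈ k/2 both sizes exceed n^{4/3}/3.
module Submission where

open import Defs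
open import Data.Fin as Fin using (Fin; zero; suc; toℕ; fromℕ<)
open import Data.Fin.Properties using (toℕ-fromℕ<; all?; any?)
open import Data.List using (List; []; [_]; _++_; length)
open import Data.List.Properties using (length-++)
open import Data.List.Membership.Propositional using (_∈_)
open import Data.List.Membership.Propositional.Properties using (∈-++⁻)
open import Data.List.Relation.Unary.All as All using (All; [])
open import Data.List.Relation.Unary.Any using (here)
open import Data.List.Relation.Unary.Unique.Propositional using (Unique; []; _∷_)
import Data.List.Relation.Unary.Unique.Propositional.Properties as Unique
open import Data.Nat
open import Data.Nat.Properties
open import Data.Nat.Tactic.RingSolver using (solve-∀)
open import Data.Product using (Σ; ∃-syntax; _×_; _,_; proj₁; proj₂)
open import Data.Sum using (_⊎_; inj₁; inj₂)
open import Data.Unit using (tt)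
open import Function using (_∘_)
open import Relation.Binary.PropositionalEquality hiding ([_])
open import Relation.Nullary using (¬_; contradiction)
open import Relation.Nullary.Decidable using (Dec; yes; no; _×-dec_; _→-dec_; toWitness)
open import Algebra.Properties.CommutativeSemigroup +-commutativeSemigroup using (interchange)

∑< : ℕ → (ℕ → ℕ) → ℕ
∑< zero    f = 0
∑< (suc n) f = ∑< n f + f n

syntax ∑< n (λ i → e) = ∑[ i < n ] e

∑-cong : ∀ n {f g} → (∀ {i} → i < n → f i ≡ g i) → ∑< n f ≡ ∑< n g
∑-cong zero    eq = refl
∑-cong (suc n) eq = cong₂ _+_ (∑-cong n (eq ∘ m<n⇒m<1+n)) (eq (n<1+n n))

∑-mono-≤ : ∀ n {f g} → (∀ {i} → i < n → f i ≤ g i) → ∑< n f ≤ ∑< n g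
∑-mono-≤ zero    le = z≤n
∑-mono-≤ (suc n) le = +-mono-≤ (∑-mono-≤ n (le ∘ m<n⇒m<1+n)) (le (n<1+n n))

∑-+ : ∀ m n f → ∑< (m + n) f ≡ ∑< m f + ∑[ i < n ] f (m + i)
∑-+ m zero    f = trans (cong (λ l → ∑< l f) (+-identityʳ m)) (sym (+-identityʳ _))
∑-+ m (suc n) f = begin
  ∑< (m + suc n) f                           ≡⟨ cong (λ l → ∑< l f) (+-suc m n) ⟩
  ∑< (m + n) f + f (m + n)                   ≡⟨ cong (_+ f (m + n)) (∑-+ m n f) ⟩
  ∑< m f + ∑[ i < n ] f (m + i) + f (m + n)  ≡⟨ +-assoc (∑< m f) _ _ ⟩
  ∑< m f + ∑[ i < suc n ] f (m + i)          ∎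
  where open ≡-Reasoning

∑-blocks : ∀ q k f → ∑< (q * k) f ≡ ∑[ a < q ] ∑[ i < k ] f (a * k + i)
∑-blocks zero    k f = refl
∑-blocks (suc q) k f = begin
  ∑< (k + q * k) f                         ≡⟨ cong (λ l → ∑< l f) (+-comm k (q * k)) ⟩
  ∑< (q * k + k) f                         ≡⟨ ∑-+ (q * k) k f ⟩
  ∑< (q * k) f + ∑[ i < k ] f (q * k + i)  ≡⟨ cong (_+ ∑[ i < k ] f (q * k + i)) (∑-blocks q k f) ⟩
  ∑[ a < suc q ] ∑[ i < k ] f (a * k + i)  ∎
  where open ≡-Reasoning

∑-distrib-+ : ∀ n f g → ∑[ i < n ] (f i + g i) ≡ ∑< n f + ∑< n g
∑-distrib-+ zero    f g = refl
∑-distrib-+ (suc n) f g =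
  trans (cong (_+ (f n + g n)) (∑-distrib-+ n f g)) (interchange (∑< n f) (∑< n g) (f n) (g n))

∑-const : ∀ n c → ∑[ i < n ] c ≡ n * c
∑-const zero    c = refl
∑-const (suc n) c = trans (cong (_+ c) (∑-const n c)) (+-comm (n * c) c)

∑-distribˡ-* : ∀ n c f → ∑[ i < n ] (c * f i) ≡ c * ∑< n f
∑-distribˡ-* zero    c f = sym (*-zeroʳ c)
∑-distribˡ-* (suc n) c f =
  trans (cong (_+ c * f n) (∑-distribˡ-* n c f)) (sym (*-distribˡ-+ c (∑< n f) (f n)))

∑-comm : ∀ m n (f : ℕ → ℕ → ℕ) → ∑[ i < m ] ∑[ j < n ] f i j ≡ ∑[ j < n ] ∑[ i < m ] f i j
∑-comm zero    n f = sym (trans (∑-const n 0) (*-zeroʳ n))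
∑-comm (suc m) n f =
  trans (cong (_+ ∑[ j < n ] f m j) (∑-comm m n f))
        (sym (∑-distrib-+ n (λ j → ∑[ i < m ] f i j) (f m)))

∑<⇒∃< : ∀ n c f → ∑< n f < n * c → ∃[ i ] (i < n × f i < c)
∑<⇒∃< (suc n) c f sum< with f n <? c
... | yes fn<c = n , n<1+n n , fn<c
... | no  fn≮c =
  let i , i<n , fi<c = ∑<⇒∃< n c f (+-cancelʳ-< c (∑< n f) (n * c) sum+c<)
  in  i , m<n⇒m<1+n i<n , fi<c
  where
  sum+c< : ∑< n f + c < n * c + c
  sum+c< = ≤-<-trans (+-monoʳ-≤ (∑< n f) (≮⇒≥ fn≮c))
                     (<-≤-trans sum< (≤-reflexive (+-comm c (n * c))))

∑≡0⇒≡0 : ∀ n f → ∑< n f ≡ 0 → ∀ {i} → i < n → f i ≡ 0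
∑≡0⇒≡0 (suc n) f sum≡0 {i} i<1+n with m≤n⇒m<n∨m≡n (≤-pred i<1+n)
... | inj₁ i<n  = ∑≡0⇒≡0 n f (m+n≡0⇒m≡0 (∑< n f) sum≡0) i<n
... | inj₂ refl = m+n≡0⇒n≡0 (∑< n f) sum≡0

𝟙 : {P : Set} → Dec P → ℕ
𝟙 (yes _) = 1
𝟙 (no  _) = 0

𝟙≡0⇒¬ : {P : Set} (P? : Dec P) → 𝟙 P? ≡ 0 → ¬ P
𝟙≡0⇒¬ (no ¬p) _ = ¬p

1≤𝟙[≡0]+ : ∀ x → 1 ≤ 𝟙 (x ≟ 0) + x
1≤𝟙[≡0]+ zero    = ≤-refl
1≤𝟙[≡0]+ (suc x) = s≤s z≤n

∑<⇒∃≡0 : ∀ k f → ∑< k f < k → ∃[ j ] (j < k × f j ≡ 0)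
∑<⇒∃≡0 k f sum<k =
  let j , j<k , fj<1 = ∑<⇒∃< k 1 f (<-≤-trans sum<k (≤-reflexive (sym (*-identityʳ k))))
  in  j , j<k , n<1⇒n≡0 fj<1

∑<⇒>zeros : ∀ k f {h e} → h + e ≡ k → ∑< k f < h → e < ∑[ i < k ] 𝟙 (f i ≟ 0)
∑<⇒>zeros k f {h} {e} h+e≡k sum<h = +-cancelʳ-< h e zeros (begin-strict
  e + h               ≡⟨ trans (+-comm e h) h+e≡k ⟩
  k                   ≤⟨ k≤zeros+∑ ⟩
  zeros + ∑< k f      <⟨ +-monoʳ-< zeros sum<h ⟩
  zeros + h           ∎)
  where
  open ≤-Reasoning
  zeros : ℕ
  zeros = ∑[ i < k ] 𝟙 (f i ≟ 0)
  k≤zeros+∑ : k ≤ zeros + ∑< k f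
  k≤zeros+∑ = begin
    k                             ≡⟨ trans (sym (*-identityʳ k)) (sym (∑-const k 1)) ⟩
    ∑[ i < k ] 1                  ≤⟨ ∑-mono-≤ k (λ {i} _ → 1≤𝟙[≡0]+ (f i)) ⟩
    ∑[ i < k ] (𝟙 (f i ≟ 0) + f i) ≡⟨ ∑-distrib-+ k _ f ⟩
    zeros + ∑< k f                ∎

concat< : {A : Set} → ℕ → (ℕ → List A) → List A
concat< zero    xs = []
concat< (suc n) xs = concat< n xs ++ xs n

syntax concat< n (λ i → xs) = concat[ i < n ] xs

module _ {A : Set} where

  length-concat< : ∀ n (xs : ℕ → List A) → length (concat< n xs) ≡ ∑[ i < n ] length (xs i)
  length-concat< zero    xs = refl
  length-concat< (suc n) xs =
    trans (length-++ (concat< n xs)) (cong (_+ length (xs n)) (length-concat< n xs))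

  ∈-concat<⁻ : ∀ n (xs : ℕ → List A) {w} → w ∈ concat< n xs → ∃[ i ] (i < n × w ∈ xs i)
  ∈-concat<⁻ (suc n) xs w∈ with ∈-++⁻ (concat< n xs) w∈
  ... | inj₂ w∈xsₙ = n , n<1+n n , w∈xsₙ
  ... | inj₁ w∈ʳ   = let i , i<n , w∈xsᵢ = ∈-concat<⁻ n xs w∈ʳ in i , m<n⇒m<1+n i<n , w∈xsᵢ

  Unique-concat< : ∀ n (xs : ℕ → List A) (κ : A → ℕ) →
    (∀ {i w} → i < n → w ∈ xs i → κ w ≡ i) → (∀ {i} → i < n → Unique (xs i)) →
    Unique (concat< n xs)
  Unique-concat< zero    xs κ key unique = []
  Unique-concat< (suc n) xs κ key unique =
    Unique.++⁺ (Unique-concat< n xs κ (key ∘ m<n⇒m<1+n) (unique ∘ m<n⇒m<1+n))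
               (unique (n<1+n n)) disjoint
    where
    disjoint : ∀ {w} → ¬ (w ∈ concat< n xs × w ∈ xs n)
    disjoint (w∈ʳ , w∈xsₙ) =
      let i , i<n , w∈xsᵢ = ∈-concat<⁻ n xs w∈ʳ
      in  <-irrefl (trans (sym (key (m<n⇒m<1+n i<n) w∈xsᵢ)) (key (n<1+n n) w∈xsₙ)) i<n

  [_∣_] : {P : Set} → A → Dec P → List A
  [ x ∣ yes _ ] = [ x ]
  [ x ∣ no  _ ] = []

  length-[∣] : {P : Set} (x : A) (P? : Dec P) → length [ x ∣ P? ] ≡ 𝟙 P?
  length-[∣] x (yes _) = refl
  length-[∣] x (no  _) = refl

  ∈-[∣]⁻ : {P : Set} {x w : A} (P? : Dec P) → w ∈ [ x ∣ P? ] → P × w ≡ x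
  ∈-[∣]⁻ (yes p) (here w≡x) = p , w≡x

  Unique-[∣] : {P : Set} (x : A) (P? : Dec P) → Unique [ x ∣ P? ]
  Unique-[∣] x (yes _) = [] ∷ []
  Unique-[∣] x (no  _) = []

Linked : (G : Graph) → V G → V G → Set
Linked G u v = Adj G u v × Adj G v u

module _ {G : Graph} {c} (col : Colouring G c) {u : V G} (L : ℕ → V G) {k : ℕ}
         (linked : ∀ {t} → suc t < k → Linked G (L t) (L (suc t)))
         (coloured : ∀ {t} → t < k → col (L t) ≡ col u) where

  MonoReach-along : ∀ {s t} → s < k → t < k → MonoReach G col u (L s) → MonoReach G col u (L t)
  MonoReach-along s<k t<k = outward t<k ∘ inward s<k
    where
    inward : ∀ {s} → s < k → MonoReach G col u (L s) → MonoReach G col u (L 0)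
    inward {zero}  _     r = r
    inward {suc s} 1+s<k r =
      inward (<⇒≤ 1+s<k) (step r (proj₂ (linked 1+s<k)) (coloured (<⇒≤ 1+s<k)))
    outward : ∀ {t} → t < k → MonoReach G col u (L 0) → MonoReach G col u (L t)
    outward {zero}  _     r = r
    outward {suc t} 1+t<k r = step (outward (<⇒≤ 1+t<k) r) (proj₁ (linked 1+t<k)) (coloured 1+t<k)

HasMonoComponentOfSize≥-mono : ∀ {G c} {col : Colouring G c} {s t} → s ≤ t →
  HasMonoComponentOfSize≥ G col t → HasMonoComponentOfSize≥ G col s
HasMonoComponentOfSize≥-mono s≤t (u , ws , unique , reach , t≤) =
  u , ws , unique , reach , ≤-trans s≤t t≤

component-cube-bound : ∀ {G c} {col : Colouring G c} {n s} → n ^ 4 ≤ (3 * s) ^ 3 →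
  HasMonoComponentOfSize≥ G col s →
  ∃[ u ] ∃[ ws ] (Unique ws × All (MonoReach G col u) ws × n ^ 4 ≤ (3 * length ws) ^ 3)
component-cube-bound bound (u , ws , unique , reach , s≤) =
  u , ws , unique , reach , ≤-trans bound (^-monoˡ-≤ 3 (*-monoʳ-≤ 3 s≤))

Fin2-≢⇒≡ : ∀ {a b c : Fin 2} → a ≢ c → b ≢ c → a ≡ b
Fin2-≢⇒≡ {zero}     {zero}                 _   _   = refl
Fin2-≢⇒≡ {suc zero} {suc zero}             _   _   = refl
Fin2-≢⇒≡ {zero}     {suc zero} {zero}      a≢c _   = contradiction refl a≢c
Fin2-≢⇒≡ {zero}     {suc zero} {suc zero}  _   b≢c = contradiction refl b≢c
Fin2-≢⇒≡ {suc zero} {zero}     {zero}      _   b≢c = contradiction refl b≢c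
Fin2-≢⇒≡ {suc zero} {zero}     {suc zero}  a≢c _   = contradiction refl a≢c

record HubGrid (G : Graph) (N : ℕ) : Set where
  field
    hub         : V G
    cell        : ℕ → ℕ → V G
    row column  : V G → ℕ
    row-cell    : ∀ {x y} → x < N → row (cell x y) ≡ x
    column-cell : ∀ {x y} → y < N → column (cell x y) ≡ y
    hub-adj     : ∀ {x y} → x < N → y < N → Adj G hub (cell x y)
    linkedʰ     : ∀ {x y} → x < N → suc y < N → Linked G (cell x y) (cell x (suc y))
    linkedᵛ     : ∀ {x y} → suc x < N → y < N → Linked G (cell x y) (cell (suc x) y)

module _ {G : Graph} {N : ℕ} (grid : HubGrid G N) (col : Colouring G 2) where
  open HubGrid grid

  red? : ∀ x y → Dec (col (cell x y) ≡ col hub)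
  red? x y = col (cell x y) Fin.≟ col hub

  reds : (x₀ y₀ k : ℕ) → ℕ
  reds x₀ y₀ k = ∑[ i < k ] ∑[ j < k ] 𝟙 (red? (x₀ + i) (y₀ + j))

  cellsOf : (x₀ y₀ k : ℕ) {P : ℕ → ℕ → Set} → (∀ i j → Dec (P i j)) → List (V G)
  cellsOf x₀ y₀ k P? = concat[ i < k ] concat[ j < k ] [ cell (x₀ + i) (y₀ + j) ∣ P? i j ]

  module _ (x₀ y₀ k : ℕ) {P : ℕ → ℕ → Set} (P? : ∀ i j → Dec (P i j)) where

    length-cellsOf : length (cellsOf x₀ y₀ k P?) ≡ ∑[ i < k ] ∑[ j < k ] 𝟙 (P? i j)
    length-cellsOf = trans (length-concat< k _) (∑-cong k λ {i} _ →
      trans (length-concat< k _) (∑-cong k λ {j} _ → length-[∣] _ (P? i j)))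

    ∈-cellsOf⁻ : ∀ {w} → w ∈ cellsOf x₀ y₀ k P? →
      ∃[ i ] ∃[ j ] (i < k × j < k × P i j × w ≡ cell (x₀ + i) (y₀ + j))
    ∈-cellsOf⁻ w∈ =
      let i , i<k , w∈ᵢ = ∈-concat<⁻ k _ w∈
          j , j<k , w∈ᵢⱼ = ∈-concat<⁻ k _ w∈ᵢ
          pᵢⱼ , w≡ = ∈-[∣]⁻ (P? i j) w∈ᵢⱼ
      in  i , j , i<k , j<k , pᵢⱼ , w≡

    Unique-cellsOf : x₀ + k ≤ N → y₀ + k ≤ N → Unique (cellsOf x₀ y₀ k P?)
    Unique-cellsOf x₀+k≤N y₀+k≤N =
      Unique-concat< k _ (λ w → row w ∸ x₀) rowKey λ {i} _ →
        Unique-concat< k _ (λ w → column w ∸ y₀) (columnKey i) λ {j} _ → Unique-[∣] _ (P? i j)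
      where
      columnKey : ∀ i {j w} → j < k → w ∈ [ cell (x₀ + i) (y₀ + j) ∣ P? i j ] → column w ∸ y₀ ≡ j
      columnKey i {j} j<k w∈ rewrite proj₂ (∈-[∣]⁻ (P? i j) w∈) =
        trans (cong (_∸ y₀) (column-cell (<-≤-trans (+-monoʳ-< y₀ j<k) y₀+k≤N))) (m+n∸m≡n y₀ j)
      rowKey : ∀ {i w} → i < k → w ∈ concat[ j < k ] [ cell (x₀ + i) (y₀ + j) ∣ P? i j ] →
        row w ∸ x₀ ≡ i
      rowKey {i} i<k w∈ with ∈-concat<⁻ k _ w∈
      ... | j , _ , w∈ⱼ rewrite proj₂ (∈-[∣]⁻ (P? i j) w∈ⱼ) =
        trans (cong (_∸ x₀) (row-cell (<-≤-trans (+-monoʳ-< x₀ i<k) x₀+k≤N))) (m+n∸m≡n x₀ i)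

  red-component : ∀ {M} → M ≤ N → HasMonoComponentOfSize≥ G col (reds 0 0 M)
  red-component {M} M≤N =
    hub , cellsOf 0 0 M red? , Unique-cellsOf 0 0 M red? M≤N M≤N ,
    All.tabulate reach , ≤-reflexive (sym (length-cellsOf 0 0 M red?))
    where
    reach : ∀ {w} → w ∈ cellsOf 0 0 M red? → MonoReach G col hub w
    reach w∈ with ∈-cellsOf⁻ 0 0 M red? w∈
    ... | i , j , i<M , j<M , red , refl =
      step here (hub-adj (<-≤-trans i<M M≤N) (<-≤-trans j<M M≤N)) red

  reds-blocks : ∀ q k → reds 0 0 (q * k) ≡ ∑[ a < q ] ∑[ b < q ] reds (a * k) (b * k) k
  reds-blocks q k = trans (∑-blocks q k _) (∑-cong q λ {a} _ →
    trans (∑-cong k (λ {i} _ → ∑-blocks q k _))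
          (∑-comm k q λ i b → ∑[ j < k ] 𝟙 (red? (a * k + i) (b * k + j))))

  linkedʰ-offset : ∀ {x y₀ t} → x < N → y₀ + suc t < N →
    Linked G (cell x (y₀ + t)) (cell x (y₀ + suc t))
  linkedʰ-offset {x} {y₀} {t} x<N y<N =
    subst (λ y → Linked G (cell x (y₀ + t)) (cell x y)) (sym (+-suc y₀ t))
          (linkedʰ x<N (subst (_< N) (+-suc y₀ t) y<N))

  linkedᵛ-offset : ∀ {x₀ y t} → x₀ + suc t < N → y < N →
    Linked G (cell (x₀ + t) y) (cell (x₀ + suc t) y)
  linkedᵛ-offset {x₀} {y} {t} x<N y<N =
    subst (λ x → Linked G (cell (x₀ + t) y) (cell x y)) (sym (+-suc x₀ t))
          (linkedᵛ (subst (_< N) (+-suc x₀ t) x<N) y<N)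

  -- A red-free column crosses every red-free row, so the red-free rows of the block
  -- form one component of the other colour.
  sparse-block : ∀ {x₀ y₀ k h e} → x₀ + k ≤ N → y₀ + k ≤ N → h + e ≡ k → reds x₀ y₀ k < h →
    HasMonoComponentOfSize≥ G col (k * suc e)
  sparse-block {x₀} {y₀} {k} {h} {e} x₀+k≤N y₀+k≤N h+e≡k sparse =
    u , cellsOf x₀ y₀ k redFree? , Unique-cellsOf x₀ y₀ k redFree? x₀+k≤N y₀+k≤N ,
    All.tabulate reach , size
    where
    x< : ∀ {i} → i < k → x₀ + i < N
    x< i<k = <-≤-trans (+-monoʳ-< x₀ i<k) x₀+k≤N
    y< : ∀ {j} → j < k → y₀ + j < N
    y< j<k = <-≤-trans (+-monoʳ-< y₀ j<k) y₀+k≤N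

    rowReds columnReds : ℕ → ℕ
    rowReds    i = ∑[ j < k ] 𝟙 (red? (x₀ + i) (y₀ + j))
    columnReds j = ∑[ i < k ] 𝟙 (red? (x₀ + i) (y₀ + j))

    redFree? : ∀ i j → Dec (rowReds i ≡ 0)
    redFree? i _ = rowReds i ≟ 0

    freeColumn : ∃[ j ] (j < k × columnReds j ≡ 0)
    freeColumn = ∑<⇒∃≡0 k columnReds (begin-strict
      ∑< k columnReds  ≡⟨ sym (∑-comm k k _) ⟩
      reds x₀ y₀ k     <⟨ sparse ⟩
      h                ≤⟨ m≤m+n h e ⟩
      h + e            ≡⟨ h+e≡k ⟩
      k                ∎)
      where open ≤-Reasoning
    j₀ : ℕ
    j₀ = proj₁ freeColumn
    j₀<k : j₀ < k
    j₀<k = proj₁ (proj₂ freeColumn)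

    blueInRow : ∀ {i j} → rowReds i ≡ 0 → j < k → col (cell (x₀ + i) (y₀ + j)) ≢ col hub
    blueInRow {i} {j} free j<k = 𝟙≡0⇒¬ (red? (x₀ + i) (y₀ + j)) (∑≡0⇒≡0 k _ free j<k)

    blueInColumn : ∀ {i} → i < k → col (cell (x₀ + i) (y₀ + j₀)) ≢ col hub
    blueInColumn {i} i<k =
      𝟙≡0⇒¬ (red? (x₀ + i) (y₀ + j₀)) (∑≡0⇒≡0 k _ (proj₂ (proj₂ freeColumn)) i<k)

    0<k : 0 < k
    0<k = ≤-<-trans z≤n j₀<k

    u : V G
    u = cell (x₀ + 0) (y₀ + j₀)

    likeU : ∀ {w} → col w ≢ col hub → col w ≡ col u
    likeU w-blue = Fin2-≢⇒≡ w-blue (blueInColumn 0<k)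

    reach : ∀ {w} → w ∈ cellsOf x₀ y₀ k redFree? → MonoReach G col u w
    reach w∈ with ∈-cellsOf⁻ x₀ y₀ k redFree? w∈
    ... | i , j , i<k , j<k , free , refl =
      MonoReach-along col (λ t → cell (x₀ + i) (y₀ + t))
        (λ 1+t<k → linkedʰ-offset (x< i<k) (y< 1+t<k)) (likeU ∘ blueInRow free) j₀<k j<k
        (MonoReach-along col (λ t → cell (x₀ + t) (y₀ + j₀))
          (λ 1+t<k → linkedᵛ-offset (x< 1+t<k) (y< j₀<k)) (likeU ∘ blueInColumn) 0<k i<k here)

    size : k * suc e ≤ length (cellsOf x₀ y₀ k redFree?)
    size = begin
      k * suc e                               ≤⟨ *-monoʳ-≤ k (∑<⇒>zeros k rowReds h+e≡k sparse) ⟩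
      k * ∑[ i < k ] 𝟙 (rowReds i ≟ 0)        ≡⟨ sym (∑-distribˡ-* k k _) ⟩
      ∑[ i < k ] (k * 𝟙 (rowReds i ≟ 0))      ≡⟨ sym (∑-cong k λ {i} _ → ∑-const k _) ⟩
      ∑[ i < k ] ∑[ j < k ] 𝟙 (redFree? i j)  ≡⟨ sym (length-cellsOf x₀ y₀ k redFree?) ⟩
      length (cellsOf x₀ y₀ k redFree?)       ∎
      where open ≤-Reasoning

  grid-clustering : ∀ {k q h e} → h + e ≡ k → q * k ≤ N →
    HasMonoComponentOfSize≥ G col (q * (q * h)) ⊎ HasMonoComponentOfSize≥ G col (k * suc e)
  grid-clustering {k} {q} {h} {e} h+e≡k qk≤N with q * (q * h) ≤? reds 0 0 (q * k)
  ... | yes many = inj₁ (HasMonoComponentOfSize≥-mono many (red-component qk≤N))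
  ... | no  few  =
    let a , a<q , sparseStrip =
          ∑<⇒∃< q (q * h) _ (subst (_< q * (q * h)) (reds-blocks q k) (≰⇒> few))
        b , b<q , sparse      = ∑<⇒∃< q h _ sparseStrip
    in  inj₂ (sparse-block (block≤N a<q) (block≤N b<q) h+e≡k sparse)
    where
    block≤N : ∀ {a} → a < q → a * k + k ≤ N
    block≤N {a} a<q = ≤-trans (≤-reflexive (+-comm (a * k) k)) (≤-trans (*-monoˡ-≤ k a<q) qk≤N)

clamp : (m x : ℕ) → Fin (suc m)
clamp m x = fromℕ< (s≤s (m⊓n≤n x m))

toℕ-clamp : ∀ {m x} → x ≤ m → toℕ (clamp m x) ≡ x
toℕ-clamp x≤m = trans (toℕ-fromℕ< _) (m≤n⇒m⊓n≡m x≤m)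

fanGrid : ∀ m → HubGrid (Fan (suc m) ⊠ Fan (suc m)) (suc m)
fanGrid m = record
  { hub         = zero , zero
  ; cell        = λ x y → suc (clamp m x) , suc (clamp m y)
  ; row         = λ (u , _) → pred (toℕ u)
  ; column      = λ (_ , v) → pred (toℕ v)
  ; row-cell    = λ x<N → toℕ-clamp (≤-pred x<N)
  ; column-cell = λ y<N → toℕ-clamp (≤-pred y<N)
  ; hub-adj     = λ _ _ → inj₂ (inj₂ (tt , tt))
  ; linkedʰ     = λ _ 1+y<N → let p = successive 1+y<N in
                    inj₁ (refl , inj₁ p) , inj₁ (refl , inj₂ p)
  ; linkedᵛ     = λ 1+x<N _ → let p = successive 1+x<N in
                    inj₂ (inj₁ (refl , inj₁ p)) , inj₂ (inj₁ (refl , inj₂ p))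
  }
  where
  successive : ∀ {x} → suc x < suc m → toℕ (clamp m (suc x)) ≡ suc (toℕ (clamp m x))
  successive 1+x<N = trans (toℕ-clamp (≤-pred 1+x<N))
                           (cong suc (sym (toℕ-clamp (≤-pred (<⇒≤ 1+x<N)))))

record Choice : Set where
  constructor choice
  field k q h e : ℕ

-- parameters for grid-clustering: q × q blocks of side k, and k = h + e
Admissible : ℕ → Choice → Set
Admissible n (choice k q h e) =
  h + e ≡ k × q * k ≤ n × n ^ 4 ≤ (3 * (q * (q * h))) ^ 3 × n ^ 4 ≤ (3 * (k * suc e)) ^ 3

admissible? : ∀ n c → Dec (Admissible n c)
admissible? n (choice k q h e) = h + e ≟ k ×-dec q * k ≤? n ×-dec _ ≤? _ ×-dec _ ≤? _

Parameters : ℕ → Set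
Parameters n = Σ Choice (Admissible n)

smallChoice : (n q′ : ℕ) → Choice
smallChoice n q′ = choice k (suc q′) (k ∸ e) e
  where
  k e : ℕ
  k = n / suc q′
  e = k / 2 ∸ 1

-- Below 1000 the cube-root choice of large-parameters fails; a suitable q is found by evaluation.
small-admissible : ∀ (n : Fin 1000) → 4 ≤ toℕ n →
  ∃[ q′ ] Admissible (toℕ n) (smallChoice (toℕ n) (toℕ {10} q′))
small-admissible = toWitness {a? = all? λ n → 4 ≤? toℕ n →-dec
  any? λ q′ → admissible? (toℕ n) (smallChoice (toℕ n) (toℕ q′))} _

small-parameters : ∀ n → 4 ≤ n → n < 1000 → Parameters n
small-parameters n 4≤n n<1000 =
  let q′ , admissible = small-admissible (fromℕ< n<1000) (subst (4 ≤_) (sym toℕ[n]≡n) 4≤n)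
  in  smallChoice n (toℕ q′) ,
      subst (λ m → Admissible m (smallChoice m (toℕ q′))) toℕ[n]≡n admissible
  where
  toℕ[n]≡n : toℕ (fromℕ< n<1000) ≡ n
  toℕ[n]≡n = toℕ-fromℕ< n<1000

cubeRoot : ∀ n → ∃[ a ] (a ^ 3 ≤ n × n < suc a ^ 3)
cubeRoot zero = 0 , z≤n , s≤s z≤n
cubeRoot (suc n) with cubeRoot n
... | a , a³≤n , n<[1+a]³ with suc a ^ 3 ≤? suc n
...   | yes [1+a]³≤1+n = suc a , [1+a]³≤1+n , <-≤-trans (s≤s n<[1+a]³) (^-monoˡ-< 3 (n<1+n (suc a)))
...   | no  [1+a]³≰1+n = a , m≤n⇒m≤1+n a³≤n , ≰⇒> [1+a]³≰1+n

10≤a⇒2*[1+a]⁴≤3*a⁴ : ∀ {a} → 10 ≤ a → 2 * suc a ^ 4 ≤ 3 * (a * a * (a * a))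
10≤a⇒2*[1+a]⁴≤3*a⁴ 10≤a with m≤n⇒∃[o]m+o≡n 10≤a
... | b , refl = ≤-trans (m≤m+n _ _) (≤-reflexive (sym (expansion b)))
  where
  expansion : ∀ b →
    3 * ((10 + b) * (10 + b) * ((10 + b) * (10 + b))) ≡
    2 * ((11 + b) * ((11 + b) * ((11 + b) * ((11 + b) * 1)))) +
    (b * b * b * b + 32 * (b * b * b) + 348 * (b * b) + 1352 * b + 718)
  expansion = solve-∀

-- (1 + a)⁴ ≤ 3Y follows once a ≥ 10, and n < (1 + a)³ turns this into n^{4/3} ≤ 3Y.
cube-root-bound : ∀ {n a} Y → 10 ≤ a → n < suc a ^ 3 → a * a * (a * a) ≤ 2 * Y → n ^ 4 ≤ (3 * Y) ^ 3
cube-root-bound {n} {a} Y 10≤a n<[1+a]³ a⁴≤2Y = begin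
  n ^ 4            ≤⟨ ^-monoˡ-≤ 4 (<⇒≤ n<[1+a]³) ⟩
  (suc a ^ 3) ^ 4  ≡⟨ trans (^-*-assoc (suc a) 3 4) (sym (^-*-assoc (suc a) 4 3)) ⟩
  (suc a ^ 4) ^ 3  ≤⟨ ^-monoˡ-≤ 3 (*-cancelˡ-≤ {suc a ^ 4} {3 * Y} 2 2*[1+a]⁴≤2*3Y) ⟩
  (3 * Y) ^ 3      ∎
  where
  open ≤-Reasoning
  2*[1+a]⁴≤2*3Y : 2 * suc a ^ 4 ≤ 2 * (3 * Y)
  2*[1+a]⁴≤2*3Y = begin
    2 * suc a ^ 4          ≤⟨ 10≤a⇒2*[1+a]⁴≤3*a⁴ 10≤a ⟩
    3 * (a * a * (a * a))  ≤⟨ *-monoʳ-≤ 3 a⁴≤2Y ⟩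
    3 * (2 * Y)            ≡⟨ trans (sym (*-assoc 3 2 Y)) (*-assoc 2 3 Y) ⟩
    2 * (3 * Y)            ∎

halves≤⇒≤2* : ∀ k c → ⌊ k /2⌋ ≤ c → ⌈ k /2⌉ ≤ c → k ≤ 2 * c
halves≤⇒≤2* k c ⌊k/2⌋≤c ⌈k/2⌉≤c = begin
  k                    ≡⟨ sym (⌊n/2⌋+⌈n/2⌉≡n k) ⟩
  ⌊ k /2⌋ + ⌈ k /2⌉    ≤⟨ +-mono-≤ ⌊k/2⌋≤c ⌈k/2⌉≤c ⟩
  c + c                ≡⟨ cong (c +_) (sym (+-identityʳ c)) ⟩
  2 * c                ∎
  where open ≤-Reasoning

k≤2*c⇒k*k≤2*[k*c] : ∀ {k c} → k ≤ 2 * c → k * k ≤ 2 * (k * c)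
k≤2*c⇒k*k≤2*[k*c] {k} {c} k≤2c = ≤-trans (*-monoʳ-≤ k k≤2c)
  (≤-reflexive (trans (sym (*-assoc k 2 c)) (trans (cong (_* c) (*-comm k 2)) (*-assoc 2 k c))))

large-parameters : ∀ n → 1000 ≤ n → Parameters n
large-parameters n 1000≤n with cubeRoot n
... | a , a³≤n , n<[1+a]³ =
  choice k a ⌈ k /2⌉ ⌊ k /2⌋ ,
  trans (+-comm ⌈ k /2⌉ ⌊ k /2⌋) (⌊n/2⌋+⌈n/2⌉≡n k) ,
  ≤-trans (≤-reflexive (cong (λ x → a * (a * x)) (sym (*-identityʳ a)))) a³≤n ,
  cube-root-bound (a * (a * ⌈ k /2⌉)) 10≤a n<[1+a]³
    (≤-trans (k≤2*c⇒k*k≤2*[k*c] (halves≤⇒≤2* k ⌈ k /2⌉ (⌊n/2⌋≤⌈n/2⌉ k) ≤-refl))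
             (≤-reflexive (cong (2 *_) (*-assoc a a ⌈ k /2⌉)))) ,
  cube-root-bound (k * suc ⌊ k /2⌋) 10≤a n<[1+a]³
    (k≤2*c⇒k*k≤2*[k*c] (halves≤⇒≤2* k (suc ⌊ k /2⌋) (n≤1+n _) (⌊n/2⌋-mono (n≤1+n (suc k)))))
  where
  k : ℕ
  k = a * a
  10≤a : 10 ≤ a
  10≤a = ≮⇒≥ λ a<10 → <⇒≱ n<[1+a]³ (≤-trans (^-monoˡ-≤ 3 a<10) 1000≤n)

parameters : ∀ n → 4 ≤ n → Parameters n
parameters n 4≤n with n <? 1000
... | yes n<1000 = small-parameters n 4≤n n<1000
... | no  n≮1000 = large-parameters n (≮⇒≥ n≮1000)

lemma16 : (n : ℕ) → 4 ≤ n → (col : Colouring (Fan n ⊠ Fan n) 2) →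
    ∃[ u ] ∃[ ws ] (Unique ws × All (MonoReach (Fan n ⊠ Fan n) col u) ws
    × n ^ 4 ≤ (3 * length ws) ^ 3)
lemma16 zero    ()
lemma16 (suc m) 4≤n col with parameters (suc m) 4≤n
... | choice k q h e , h+e≡k , qk≤n , red-bound , blue-bound
  with grid-clustering (fanGrid m) col {q = q} h+e≡k qk≤n
... | inj₁ red  = component-cube-bound {n = suc m} red-bound red
... | inj₂ blue = component-cube-bound {n = suc m} blue-bound blue
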